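{- Let $\Sigma=(G,\sigma)$ be a distance compatible signed graph whose underlying graph $G$ has $n\ge 2$ vertices. Then $1\le \dim(\Sigma)\le \dim(G)\le n-1$.
   Context: All graphs are finite, simple and connected. A signed graph is $\Sigma=(G,\sigma)$ with $G=(V,E)$ and $\sigma:E\to\{+1,-1\}$. The sign of a path is the product of its edge signs; $d(u,v)$ is the distance in $G$. $\Sigma$ is distance compatible if for all $u,v$ all shortest $u$–$v$ paths in $G$ have the same sign $\sigma(uv)$; then $d_\Sigma(u,v)=\sigma(uv)d(u,v)$ (and $d_\Sigma(u,u)=0$). For an ordered vertex set $W=(w_1,\dots,w_k)$, $r_\Sigma(v|W)=(d_\Sigma(v,w_1),\dots,d_\Sigma(v,w_k))$; $W$ is resolving if distinct vertices have distinct representations. $\dim(\Sigma)$ is the minimum cardinality of a resolving set of $\Sigma$; $\dim(G)$ is the usual metric dimension of $G$ (same definition with $d$ in place of $d_\Sigma$). -}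

module Defs where

open import Data.Nat using (ℕ; zero; suc; _≤_)
open import Data.Fin using (Fin)
open import Data.Integer using (ℤ; _◃_)
open import Data.Sign using (Sign; _*_) renaming (+ to plus)
open import Data.List using (List; map; length)
open import Data.List.Relation.Unary.Unique.Propositional using (Unique)
open import Data.Product using (Σ; _×_; ∃)
open import Relation.Binary.PropositionalEquality using (_≡_)
open import Relation.Nullary using (¬_)

record Graph (n : ℕ) : Set₁ where
  field
    Adj   : Fin n → Fin n → Set
    sym   : ∀ {u v} → Adj u v → Adj v u
    irrefl : ∀ {u} → ¬ Adj u u
open Graph public

data Walk {n} (G : Graph n) : Fin n → Fin n → ℕ → Set where
  nil  : ∀ {u} → Walk G u u zero
  cons : ∀ {u w v k} → Adj G u w → Walk G w v k → Walk G u v (suc k)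

Connected : ∀ {n} → Graph n → Set
Connected {n} G = (u v : Fin n) → Σ ℕ λ k → Walk G u v k

IsDistance : ∀ {n} → Graph n → (Fin n → Fin n → ℕ) → Set
IsDistance {n} G d =
  ((u v : Fin n) → Walk G u v (d u v)) ×
  ((u v : Fin n) (k : ℕ) → Walk G u v k → d u v ≤ k)

-- Edge signing: a symmetric sign function (only its values on edges matter).
SymSign : ℕ → Set
SymSign n = Σ (Fin n → Fin n → Sign) λ σ → ∀ u v → σ u v ≡ σ v u

walkSign : ∀ {n} {G : Graph n} → (Fin n → Fin n → Sign) →
           ∀ {u v k} → Walk G u v k → Sign
walkSign σ nil = plus
walkSign σ (cons {u} {w} _ p) = σ u w * walkSign σ p

-- Distance compatibility witnessed by τ: every shortest u–v walk
-- (i.e. of length d u v; shortest walks are paths) has sign τ u v.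
CompatibleVia : ∀ {n} (G : Graph n) (σ : Fin n → Fin n → Sign)
                (d : Fin n → Fin n → ℕ) (τ : Fin n → Fin n → Sign) → Set
CompatibleVia {n} G σ d τ =
  (u v : Fin n) (p : Walk G u v (d u v)) → walkSign σ p ≡ τ u v

signedDist : ∀ {n} → (Fin n → Fin n → ℕ) → (Fin n → Fin n → Sign) →
             Fin n → Fin n → ℤ
signedDist d τ u v = τ u v ◃ d u v

Resolving : ∀ {n} {A : Set} → (Fin n → Fin n → A) → List (Fin n) → Set
Resolving {n} D W =
  (x y : Fin n) → map (D x) W ≡ map (D y) W → x ≡ y

IsMetricDim : ∀ {n} {A : Set} → (Fin n → Fin n → A) → ℕ → Set
IsMetricDim {n} D k =
  (Σ (List (Fin n)) λ W → Unique W × Resolving D W × length W ≡ k) ×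
  ((W : List (Fin n)) → Unique W → Resolving D W → k ≤ length W)

{-# OPTIONS --safe #-}
module Submission where

-- Since |d_Σ(u,v)| = d(u,v), every resolving set of G resolves Σ, giving dim Σ ≤ dim G.
-- A vertex is the unique vertex at distance 0 from itself, so the set of all
-- vertices but one resolves G, giving dim G ≤ n − 1; and with two vertices the
-- empty set resolves nothing, giving 1 ≤ dim Σ.

open import Defs hiding (sym)
open import Data.Nat using (ℕ; _≤_; _∸_; suc; z≤n; s≤s)
open import Data.Nat.Properties using (n≤0⇒n≡0)
open import Data.Fin using (Fin; zero; suc; _≟_)
open import Data.Fin.Properties using (suc-injective)
open import Data.Sign using (Sign)
open import Data.Product using (_×_; proj₁; proj₂; _,_)
open import Data.List using (List; []; _∷_; map; length; tabulate)
open import Data.List.Properties using (∷-injective; map-cong; map-∘; length-tabulate)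
open import Data.List.Membership.Propositional using (_∈_)
open import Data.List.Membership.Propositional.Properties using (∈-tabulate⁺)
open import Data.List.Relation.Unary.Any using (here; there)
open import Data.List.Relation.Unary.Unique.Propositional.Properties using (tabulate⁺)
open import Data.Integer using (∣_∣)
open import Data.Integer.Properties using (abs-◃)
open import Relation.Binary.PropositionalEquality
  using (_≡_; _≢_; refl; sym; trans; cong; subst; module ≡-Reasoning)
open import Function using (_∘_)
open import Relation.Nullary using (yes; no)

map-≡⇒≡-at : ∀ {A B : Set} {f g : A → B} {xs : List A} {x : A} →
             x ∈ xs → map f xs ≡ map g xs → f x ≡ g x
map-≡⇒≡-at {xs = _ ∷ _} (here refl) eq = proj₁ (∷-injective eq)
map-≡⇒≡-at {xs = _ ∷ _} (there x∈xs) eq = map-≡⇒≡-at x∈xs (proj₂ (∷-injective eq))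

module _ {n : ℕ} where

  Resolving-reflect : ∀ {A B : Set} {D : Fin n → Fin n → A} {E : Fin n → Fin n → B}
    {W : List (Fin n)} (h : A → B) → (∀ x y → h (D x y) ≡ E x y) →
    Resolving E W → Resolving D W
  Resolving-reflect {D = D} {E} {W} h hD≗E resE x y Dx≡Dy = resE x y (begin
    map (E x) W          ≡⟨ map-cong (λ w → sym (hD≗E x w)) W ⟩
    map (h ∘ D x) W      ≡⟨ map-∘ W ⟩
    map h (map (D x) W)  ≡⟨ cong (map h) Dx≡Dy ⟩
    map h (map (D y) W)  ≡⟨ map-∘ W ⟨
    map (h ∘ D y) W      ≡⟨ map-cong (hD≗E y) W ⟩
    map (E y) W          ∎)
    where open ≡-Reasoning

  Resolving⇒1≤length : ∀ {A : Set} {D : Fin n → Fin n → A} {u v : Fin n} →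
                       u ≢ v → ∀ {W} → Resolving D W → 1 ≤ length W
  Resolving⇒1≤length u≢v {[]}    res with () ← u≢v (res _ _ refl)
  Resolving⇒1≤length u≢v {_ ∷ _} _   = s≤s z≤n

  module _ {G : Graph n} {d : Fin n → Fin n → ℕ} (dist : IsDistance G d) where

    distance-self : ∀ u → d u u ≡ 0
    distance-self u = n≤0⇒n≡0 (proj₂ dist u u 0 nil)

    distance-zero⇒≡ : ∀ {u v} → d u v ≡ 0 → u ≡ v
    distance-zero⇒≡ {u} {v} duv≡0 = walk₀⇒≡ (subst (Walk G u v) duv≡0 (proj₁ dist u v))
      where
      walk₀⇒≡ : ∀ {u v} → Walk G u v 0 → u ≡ v
      walk₀⇒≡ nil = refl

    all-but-one-resolving : (z : Fin n) {W : List (Fin n)} →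
                            (∀ v → v ≢ z → v ∈ W) → Resolving d W
    all-but-one-resolving z covers x y dx≡dy with x ≟ z | y ≟ z
    ... | yes refl | yes refl = refl
    ... | no x≢z | _ = sym (distance-zero⇒≡
      (trans (sym (map-≡⇒≡-at (covers x x≢z) dx≡dy)) (distance-self x)))
    ... | _ | no y≢z = distance-zero⇒≡
      (trans (map-≡⇒≡-at (covers y y≢z) dx≡dy) (distance-self y))

  signed-resolving : ∀ {d : Fin n → Fin n → ℕ} (τ : Fin n → Fin n → Sign) {W} →
                     Resolving d W → Resolving (signedDist d τ) W
  signed-resolving {d} τ = Resolving-reflect ∣_∣ (λ x y → abs-◃ (τ x y) (d x y))

≢zero⇒∈-tabulate-suc : ∀ {m} (v : Fin (suc m)) → v ≢ zero → v ∈ tabulate suc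
≢zero⇒∈-tabulate-suc zero    v≢0 with () ← v≢0 refl
≢zero⇒∈-tabulate-suc (suc i) _   = ∈-tabulate⁺ i

theorem2p2 : (n : ℕ) → 2 ≤ n → (G : Graph n) → Connected G →
    (σ : SymSign n) → (d : Fin n → Fin n → ℕ) → IsDistance G d →
    (τ : Fin n → Fin n → Sign) → CompatibleVia G (proj₁ σ) d τ →
    (dimΣ dimG : ℕ) → IsMetricDim (signedDist d τ) dimΣ → IsMetricDim d dimG →
    (1 ≤ dimΣ) × (dimΣ ≤ dimG) × (dimG ≤ n ∸ 1)
theorem2p2 .(suc (suc m)) (s≤s (s≤s {n = m} z≤n)) _ _ _ d dist τ _ _ _
  ((_ , _ , resΣ , refl) , minΣ) ((WG , uniqueG , resG , refl) , minG) =
  Resolving⇒1≤length {u = zero} {v = suc zero} (λ ()) resΣ ,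
  minΣ WG uniqueG (signed-resolving τ resG) ,
  dimG≤n∸1
  where
  dimG≤n∸1 : length WG ≤ suc m
  dimG≤n∸1 = subst (length WG ≤_) (length-tabulate suc)
    (minG (tabulate suc) (tabulate⁺ suc-injective)
      (all-but-one-resolving dist zero ≢zero⇒∈-tabulate-suc))
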